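{- For any defeasible theory $D$, the logic program $\mathcal M_{\partial_{||}}(D)$ is call-consistent and the logic program $\mathcal M_{\partial^*_{||}}(D)$ is stratified.
   Context: Defeasible theories. A literal is an atom $p(t_1,\dots,t_n)$ or its classical negation. A defeasible theory $D=(F,R,>)$ consists of a finite set $F$ of variable-free literals (facts), a finite set $R$ of labelled rules with a finite antecedent set of literals, a consequent literal and a kind strict ($\to$), defeasible ($\Rightarrow$) or defeater ($\leadsto$), and an acyclic superiority relation $>$ on labels. Metaprograms. $D$ is represented by unit clauses $\mathtt{fact}(q)$ ($q\in F$), $\mathtt{strict}(r,q,[q_1,\dots,q_n])$, $\mathtt{defeasible}(r,q,[q_1,\dots,q_n])$, $\mathtt{defeater}(r,q,[q_1,\dots,q_n])$ (rules $r:q_1,\dots,q_n\hookrightarrow q$ of the respective kind), $\mathtt{sup}(r,s)$ ($r>s$); predicates of $D$ are function symbols and $\neg p(\vec t)$ is written $\mathtt{not\_p}(\vec t)$; for each predicate $p$ also $\mathtt{neg}(\mathtt{p}(\vec X),\mathtt{not\_p}(\vec X))$ and $\mathtt{neg}(\mathtt{not\_p}(\vec X),\mathtt{p}(\vec X))$. $\mathcal M_{\partial_{||}}(D)$ is this with: $\mathtt{rule}(R,H,B)\,\text{:- }\,\mathtt{strict\_or\_defeasible}(R,H,B)$; $\mathtt{rule}(R,H,B)\,\text{:- }\,\mathtt{defeater}(R,H,B)$; $\mathtt{strict\_or\_defeasible}(R,H,B)\,\text{:- }\,\mathtt{strict}(R,H,B)$; $\mathtt{strict\_or\_defeasible}(R,H,B)\,\text{:-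 }\,\mathtt{defeasible}(R,H,B)$; for $\tau\in\{\mathtt{definitely},\mathtt{lambda},\mathtt{defeasibly}\}$: $\mathtt{loop\_}\tau([\,])$, $\mathtt{loop\_}\tau([H|T])\,\text{:- }\,\tau(H),\mathtt{loop\_}\tau(T)$; $\mathtt{definitely}(X)\,\text{:- }\,\mathtt{fact}(X)$; $\mathtt{definitely}(X)\,\text{:- }\,\mathtt{strict}(R,X,Y),\mathtt{loop\_definitely}(Y)$; $\mathtt{lambda}(X)\,\text{:- }\,\mathtt{definitely}(X)$; $\mathtt{lambda}(X)\,\text{:- }\,\mathtt{neg}(X,X'),\ not\ \mathtt{definitely}(X'),\ \mathtt{strict\_or\_defeasible}(R,X,Y),\ \mathtt{loop\_lambda}(Y)$; $\mathtt{defeasibly}(X)\,\text{:- }\,\mathtt{definitely}(X)$; $\mathtt{defeasibly}(X)\,\text{:- }\,\mathtt{neg}(X,X'),\ not\ \mathtt{definitely}(X'),\ \mathtt{strict\_or\_defeasible}(R,X,Y),\ \mathtt{loop\_defeasibly}(Y),\ not\ \mathtt{overruled}(X)$; $\mathtt{overruled}(X)\,\text{:- }\,\mathtt{neg}(X,X'),\ \mathtt{rule}(S,X',U),\ \mathtt{loop\_lambda}(U),\ not\ \mathtt{defeated}(S,X')$; $\mathtt{defeated}(S,X')\,\text{:- }\,\mathtt{neg}(X,X'),\ \mathtt{sup}(T,S),\ \mathtt{strict\_or\_defeasible}(T,X,V),\ \mathtt{loop\_defeasibly}(V)$. $\mathcal M_{\partial^*_{||}}(D)$ is identical except its last three clauses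 are replaced by: $\mathtt{defeasibly}(X)\,\text{:- }\,\mathtt{neg}(X,X'),\ not\ \mathtt{definitely}(X'),\ \mathtt{strict\_or\_defeasible}(R,X,Y),\ \mathtt{loop\_defeasibly}(Y),\ not\ \mathtt{overruled}(R,X)$; $\mathtt{overruled}(R,X)\,\text{:- }\,\mathtt{neg}(X,X'),\ \mathtt{rule}(S,X',U),\ \mathtt{loop\_lambda}(U),\ not\ \mathtt{defeats}(R,S)$; $\mathtt{defeats}(R,S)\,\text{:- }\,\mathtt{sup}(R,S)$. Logic programs. $p\sqsupseteq_{+1}q$ ($p\sqsupseteq_{ -1}q$) if some clause has head predicate $p$ and a positive (negative) body literal with predicate $q$; $\geq_{+1},\geq_{ -1}$ are the least relations with $p\geq_{+1}p$ and ($p\sqsupseteq_i q$, $q\geq_j r$ imply $p\geq_{i\cdot j}r$). A program is call-consistent if no predicate $p$ has $p\geq_{ -1}p$. A program is stratified if there is a mapping $m$ from predicates to non-negative integers such that for every clause $m(\text{head})\geq m(B)$ for each positive body literal $B$ and $m(\text{head})>m(C)$ for each negative body literal $not\ C$. -}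

module Defs where

open import Data.Nat using (ℕ; _≤_; _<_)
open import Data.Bool using (Bool; true; false)
open import Data.List using (List; []; _∷_; _++_; map; concatMap; upTo)
open import Data.List.Relation.Unary.All using (All)
open import Data.List.Membership.Propositional using (_∈_)
open import Data.Product using (_×_; _,_; Σ)
open import Relation.Nullary using (¬_)
open import Relation.Binary.Construct.Closure.Transitive using (TransClosure)

data Term (F : Set) : Set where
  var : ℕ → Term F
  app : F → List (Term F) → Term F

record Atom (P F : Set) : Set where
  constructor atom
  field
    pred : P
    args : List (Term F)
open Atom public

data BodyLit (P F : Set) : Set where
  pos : Atom P F → BodyLit P F
  naf : Atom P F → BodyLit P F

infix 4 _:-_
record Clause (P F : Set) : Set where
  constructor _:-_
  field
    head : Atom P F
    body : List (BodyLit P F)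
open Clause public

Program : Set → Set → Set
Program P F = List (Clause P F)

data Sign : Set where
  plus minus : Sign

_·_ : Sign → Sign → Sign
plus  · j     = j
minus · plus  = minus
minus · minus = plus

data Direct {P F : Set} (Π : Program P F) : Sign → P → P → Set where
  dpos : ∀ {c a} → c ∈ Π → pos a ∈ body c → Direct Π plus  (pred (head c)) (pred a)
  dneg : ∀ {c a} → c ∈ Π → naf a ∈ body c → Direct Π minus (pred (head c)) (pred a)

data Geq {P F : Set} (Π : Program P F) : Sign → P → P → Set where
  here : ∀ {p} → Geq Π plus p p
  step : ∀ {i j p q r} → Direct Π i p q → Geq Π j q r → Geq Π (i · j) p r

CallConsistent : {P F : Set} → Program P F → Set
CallConsistent {P} Π = ∀ (p : P) → ¬ Geq Π minus p p

Stratified : {P F : Set} → Program P F → Set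
Stratified {P} {F} Π =
  Σ (P → ℕ) λ m → ∀ (c : Clause P F) → c ∈ Π →
      (∀ (b : Atom P F) → pos b ∈ body c → m (pred b) ≤ m (pred (head c)))
    × (∀ (b : Atom P F) → naf b ∈ body c → m (pred b) < m (pred (head c)))

-- Defeasible theories over predicate symbols Pr, function symbols Fun
-- (constants = nullary function symbols) and rule labels Lab.

data GroundTerm {F : Set} : Term F → Set where
  app : ∀ f ts → All GroundTerm ts → GroundTerm (app f ts)

record DLit (Pr Fun : Set) : Set where
  constructor dlit
  field
    positive  : Bool
    predicate : Pr
    terms     : List (Term Fun)
open DLit public

GroundLit : {Pr Fun : Set} → DLit Pr Fun → Set
GroundLit l = All GroundTerm (terms l)

data Kind : Set where
  strictK defeasibleK defeaterK : Kind

record DRule (Pr Fun Lab : Set) : Set where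
  constructor mkRule
  field
    label      : Lab
    kind       : Kind
    antecedent : List (DLit Pr Fun)
    consequent : DLit Pr Fun
open DRule public

record Theory (Pr Fun Lab : Set) : Set where
  field
    preds       : List Pr
    arity       : Pr → ℕ
    facts       : List (DLit Pr Fun)
    factsGround : All GroundLit facts
    rules       : List (DRule Pr Fun Lab)
    sup         : List (Lab × Lab)   -- (r , s) ∈ sup  means  r > s
    supAcyclic  : ∀ (r : Lab) → ¬ TransClosure (λ a b → (a , b) ∈ sup) r r
open Theory public

data MetaPred : Set where
  fact strict defeasible defeater sup′ neg rule strictOrDefeasible : MetaPred
  loopDefinitely loopLambda loopDefeasibly : MetaPred
  definitely lambda defeasibly : MetaPred
  overruled₁ defeated : MetaPred     -- overruled/1, defeated/2  (M_∂||)
  overruled₂ defeats  : MetaPred     -- overruled/2, defeats/2   (M_∂*||)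

data MetaFun (Pr Fun Lab : Set) : Set where
  obj   : Fun → MetaFun Pr Fun Lab
  posP  : Pr → MetaFun Pr Fun Lab       -- p     (predicate of D as function symbol)
  notP  : Pr → MetaFun Pr Fun Lab
  lab   : Lab → MetaFun Pr Fun Lab
  nil   : MetaFun Pr Fun Lab
  cons  : MetaFun Pr Fun Lab

module Meta {Pr Fun Lab : Set} (D : Theory Pr Fun Lab) where

  MF : Set
  MF = MetaFun Pr Fun Lab

  MTerm : Set
  MTerm = Term MF

  MClause : Set
  MClause = Clause MetaPred MF

  mutual
    trT : Term Fun → MTerm
    trT (var n)    = var n
    trT (app f ts) = app (obj f) (trTs ts)

    trTs : List (Term Fun) → List MTerm
    trTs []       = []
    trTs (t ∷ ts) = trT t ∷ trTs ts

  trL : DLit Pr Fun → MTerm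
  trL (dlit true  p ts) = app (posP p) (trTs ts)
  trL (dlit false p ts) = app (notP p) (trTs ts)

  mlist : List MTerm → MTerm
  mlist []       = app nil []
  mlist (t ∷ ts) = app cons (t ∷ mlist ts ∷ [])

  infix 30 _⟨_⟩
  _⟨_⟩ : MetaPred → List MTerm → Atom MetaPred MF
  q ⟨ ts ⟩ = atom q ts

  unit : Atom MetaPred MF → MClause
  unit a = a :- []

  factClause : DLit Pr Fun → MClause
  factClause q = unit (fact ⟨ trL q ∷ [] ⟩)

  kindPred : Kind → MetaPred
  kindPred strictK     = strict
  kindPred defeasibleK = defeasible
  kindPred defeaterK   = defeater

  ruleClause : DRule Pr Fun Lab → MClause
  ruleClause r = unit (kindPred (kind r) ⟨ app (lab (label r)) []
                                        ∷ trL (consequent r)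
                                        ∷ mlist (map trL (antecedent r)) ∷ [] ⟩)

  supClause : Lab × Lab → MClause
  supClause (r , s) = unit (sup′ ⟨ app (lab r) [] ∷ app (lab s) [] ∷ [] ⟩)

  negClauses : Pr → List MClause
  negClauses p =
      unit (neg ⟨ app (posP p) xs ∷ app (notP p) xs ∷ [] ⟩)
    ∷ unit (neg ⟨ app (notP p) xs ∷ app (posP p) xs ∷ [] ⟩) ∷ []
    where xs = map var (upTo (arity D p))

  representation : List MClause
  representation = map factClause (facts D)
                ++ map ruleClause (rules D)
                ++ map supClause (sup D)
                ++ concatMap negClauses (preds D)

  X X′ R Y S U T V H Tl B : MTerm
  X  = var 0
  X′ = var 1
  R  = var 2
  Y  = var 3
  S  = var 4
  U  = var 5
  T  = var 6
  V  = var 7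
  H  = var 8
  Tl = var 9
  B  = var 10

  loopClauses : MetaPred → MetaPred → List MClause
  loopClauses loopτ τ =
      unit (loopτ ⟨ app nil [] ∷ [] ⟩)
    ∷ (loopτ ⟨ app cons (H ∷ Tl ∷ []) ∷ [] ⟩ :- (pos (τ ⟨ H ∷ [] ⟩) ∷ pos (loopτ ⟨ Tl ∷ [] ⟩) ∷ []))
    ∷ []

  common : List MClause
  common =
      (rule ⟨ R ∷ H ∷ B ∷ [] ⟩ :- (pos (strictOrDefeasible ⟨ R ∷ H ∷ B ∷ [] ⟩) ∷ []))
    ∷ (rule ⟨ R ∷ H ∷ B ∷ [] ⟩ :- (pos (defeater ⟨ R ∷ H ∷ B ∷ [] ⟩) ∷ []))
    ∷ (strictOrDefeasible ⟨ R ∷ H ∷ B ∷ [] ⟩ :- (pos (strict ⟨ R ∷ H ∷ B ∷ [] ⟩) ∷ []))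
    ∷ (strictOrDefeasible ⟨ R ∷ H ∷ B ∷ [] ⟩ :- (pos (defeasible ⟨ R ∷ H ∷ B ∷ [] ⟩) ∷ []))
    ∷ loopClauses loopDefinitely definitely
    ++ loopClauses loopLambda lambda
    ++ loopClauses loopDefeasibly defeasibly
    ++ (definitely ⟨ X ∷ [] ⟩ :- (pos (fact ⟨ X ∷ [] ⟩) ∷ []))
    ∷ (definitely ⟨ X ∷ [] ⟩ :- (pos (strict ⟨ R ∷ X ∷ Y ∷ [] ⟩) ∷ pos (loopDefinitely ⟨ Y ∷ [] ⟩) ∷ []))
    ∷ (lambda ⟨ X ∷ [] ⟩ :- (pos (definitely ⟨ X ∷ [] ⟩) ∷ []))
    ∷ (lambda ⟨ X ∷ [] ⟩ :- ( pos (neg ⟨ X ∷ X′ ∷ [] ⟩)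
                           ∷ naf (definitely ⟨ X′ ∷ [] ⟩)
                           ∷ pos (strictOrDefeasible ⟨ R ∷ X ∷ Y ∷ [] ⟩)
                           ∷ pos (loopLambda ⟨ Y ∷ [] ⟩) ∷ []))
    ∷ (defeasibly ⟨ X ∷ [] ⟩ :- (pos (definitely ⟨ X ∷ [] ⟩) ∷ []))
    ∷ []

  lastPar : List MClause
  lastPar =
      (defeasibly ⟨ X ∷ [] ⟩ :- ( pos (neg ⟨ X ∷ X′ ∷ [] ⟩)
                               ∷ naf (definitely ⟨ X′ ∷ [] ⟩)
                               ∷ pos (strictOrDefeasible ⟨ R ∷ X ∷ Y ∷ [] ⟩)
                               ∷ pos (loopDefeasibly ⟨ Y ∷ [] ⟩)
                               ∷ naf (overruled₁ ⟨ X ∷ [] ⟩) ∷ []))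
    ∷ (overruled₁ ⟨ X ∷ [] ⟩ :- ( pos (neg ⟨ X ∷ X′ ∷ [] ⟩)
                               ∷ pos (rule ⟨ S ∷ X′ ∷ U ∷ [] ⟩)
                               ∷ pos (loopLambda ⟨ U ∷ [] ⟩)
                               ∷ naf (defeated ⟨ S ∷ X′ ∷ [] ⟩) ∷ []))
    ∷ (defeated ⟨ S ∷ X′ ∷ [] ⟩ :- ( pos (neg ⟨ X ∷ X′ ∷ [] ⟩)
                                  ∷ pos (sup′ ⟨ T ∷ S ∷ [] ⟩)
                                  ∷ pos (strictOrDefeasible ⟨ T ∷ X ∷ V ∷ [] ⟩)
                                  ∷ pos (loopDefeasibly ⟨ V ∷ [] ⟩) ∷ []))
    ∷ []

  lastStar : List MClause
  lastStar =
      (defeasibly ⟨ X ∷ [] ⟩ :- ( pos (neg ⟨ X ∷ X′ ∷ [] ⟩)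
                               ∷ naf (definitely ⟨ X′ ∷ [] ⟩)
                               ∷ pos (strictOrDefeasible ⟨ R ∷ X ∷ Y ∷ [] ⟩)
                               ∷ pos (loopDefeasibly ⟨ Y ∷ [] ⟩)
                               ∷ naf (overruled₂ ⟨ R ∷ X ∷ [] ⟩) ∷ []))
    ∷ (overruled₂ ⟨ R ∷ X ∷ [] ⟩ :- ( pos (neg ⟨ X ∷ X′ ∷ [] ⟩)
                                   ∷ pos (rule ⟨ S ∷ X′ ∷ U ∷ [] ⟩)
                                   ∷ pos (loopLambda ⟨ U ∷ [] ⟩)
                                   ∷ naf (defeats ⟨ R ∷ S ∷ [] ⟩) ∷ []))
    ∷ (defeats ⟨ R ∷ S ∷ [] ⟩ :- (pos (sup′ ⟨ R ∷ S ∷ [] ⟩) ∷ []))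
    ∷ []

M-∂∥ : {Pr Fun Lab : Set} → Theory Pr Fun Lab → Program MetaPred (MetaFun Pr Fun Lab)
M-∂∥ D = representation ++ common ++ lastPar
  where open Meta D

M-∂*∥ : {Pr Fun Lab : Set} → Theory Pr Fun Lab → Program MetaPred (MetaFun Pr Fun Lab)
M-∂*∥ D = representation ++ common ++ lastStar
  where open Meta D

{-# OPTIONS --safe #-}
-- In M_∂∥(D) the only recursion through negation is the cycle
--   defeasibly → not overruled → not defeated → loop_defeasibly → defeasibly,
-- which passes through an even number of negations.  Ranking the predicates
-- into levels and giving overruled alone the sign −1 inside its level, every
-- dependency either descends in rank or stays in its level with the signs
-- multiplying consistently; hence every path from p back to p is positive.
-- In M_∂*∥(D) defeats depends only on sup, so the cycle is cut and a plain
-- level mapping is a stratification.  The clauses representing D itself are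
-- bodiless and constrain nothing.
module Submission where

open import Defs
open import Data.Nat using (ℕ; _≤_; _<_; _≟_; _<?_; _≤?_)
open import Data.Nat.Properties using (≤-reflexive; <-trans; ≤-<-trans; <-≤-trans; <-irrefl)
open import Data.Product using (_×_; _,_)
open import Data.Sum using (_⊎_; inj₁; inj₂)
open import Data.List using ([]; _∷_; _++_)
open import Data.List.Relation.Unary.All as All using (All; []; _∷_; all?)
open import Data.List.Relation.Unary.All.Properties using (++⁺; map⁺; concat⁺)
open import Relation.Nullary using (Dec; yes; no; ¬_)
open import Relation.Nullary.Decidable using (_×-dec_; _⊎-dec_; toWitness)
open import Relation.Binary.PropositionalEquality using (_≡_; refl; trans; cong)
open Relation.Binary.PropositionalEquality.≡-Reasoning

·-assoc : ∀ i j k → i · (j · k) ≡ (i · j) · k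
·-assoc plus  j     k     = refl
·-assoc minus plus  k     = refl
·-assoc minus minus plus  = refl
·-assoc minus minus minus = refl

_≟ˢ_ : (i j : Sign) → Dec (i ≡ j)
plus  ≟ˢ plus  = yes refl
plus  ≟ˢ minus = no λ ()
minus ≟ˢ plus  = no λ ()
minus ≟ˢ minus = yes refl

s≢minus·s : ∀ s → ¬ s ≡ minus · s
s≢minus·s plus  ()
s≢minus·s minus ()

module _ {P F : Set} (ok : Sign → P → P → Set) where

  LiteralRespects : P → BodyLit P F → Set
  LiteralRespects h (pos a) = ok plus  h (pred a)
  LiteralRespects h (naf a) = ok minus h (pred a)

  ClauseRespects : Clause P F → Set
  ClauseRespects c = All (LiteralRespects (pred (head c))) (body c)

  ProgramRespects : Program P F → Set
  ProgramRespects = All ClauseRespects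

  bodiless⇒respects : ∀ {c} → body c ≡ [] → ClauseRespects c
  bodiless⇒respects {a :- .[]} refl = []

  direct⇒respects : ∀ {Π i p q} → ProgramRespects Π → Direct Π i p q → ok i p q
  direct⇒respects Π-ok (dpos c∈Π a∈c) = All.lookup (All.lookup Π-ok c∈Π) a∈c
  direct⇒respects Π-ok (dneg c∈Π a∈c) = All.lookup (All.lookup Π-ok c∈Π) a∈c

  module _ (ok? : ∀ i p q → Dec (ok i p q)) where

    literalRespects? : ∀ h l → Dec (LiteralRespects h l)
    literalRespects? h (pos a) = ok? plus  h (pred a)
    literalRespects? h (naf a) = ok? minus h (pred a)

    programRespects? : ∀ Π → Dec (ProgramRespects Π)
    programRespects? = all? λ c → all? (literalRespects? (pred (head c))) (body c)

StratumOrder : {P : Set} → (P → ℕ) → Sign → P → P → Set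
StratumOrder m plus  p q = m q ≤ m p
StratumOrder m minus p q = m q < m p

stratumOrder? : {P : Set} (m : P → ℕ) → ∀ i p q → Dec (StratumOrder m i p q)
stratumOrder? m plus  p q = m q ≤? m p
stratumOrder? m minus p q = m q <? m p

respects⇒stratified : {P F : Set} {Π : Program P F} (m : P → ℕ) →
  ProgramRespects (StratumOrder m) Π → Stratified Π
respects⇒stratified m Π-ok =
  m , λ c c∈Π → (λ b b∈c → direct⇒respects (StratumOrder m) Π-ok (dpos c∈Π b∈c))
              , (λ b b∈c → direct⇒respects (StratumOrder m) Π-ok (dneg c∈Π b∈c))

SignedDescent : {P : Set} → (P → ℕ) → (P → Sign) → Sign → P → P → Set
SignedDescent r s i p q = r q < r p ⊎ (r q ≡ r p × s p ≡ i · s q)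

signedDescent? : {P : Set} (r : P → ℕ) (s : P → Sign) →
  ∀ i p q → Dec (SignedDescent r s i p q)
signedDescent? r s i p q = (r q <? r p) ⊎-dec ((r q ≟ r p) ×-dec (s p ≟ˢ (i · s q)))

module _ {P : Set} (r : P → ℕ) (s : P → Sign) where

  signedDescent-refl : ∀ {p} → SignedDescent r s plus p p
  signedDescent-refl = inj₂ (refl , refl)

  signedDescent-trans : ∀ {i j p q u} → SignedDescent r s i p q → SignedDescent r s j q u →
    SignedDescent r s (i · j) p u
  signedDescent-trans (inj₁ q<p) (inj₁ u<q) = inj₁ (<-trans u<q q<p)
  signedDescent-trans (inj₁ q<p) (inj₂ (u≡q , _)) = inj₁ (≤-<-trans (≤-reflexive u≡q) q<p)
  signedDescent-trans (inj₂ (q≡p , _)) (inj₁ u<q) = inj₁ (<-≤-trans u<q (≤-reflexive q≡p))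
  signedDescent-trans {i} {j} {p} {q} {u} (inj₂ (q≡p , sp)) (inj₂ (u≡q , sq)) =
    inj₂ (trans u≡q q≡p , (begin
      s p           ≡⟨ sp ⟩
      i · s q       ≡⟨ cong (i ·_) sq ⟩
      i · (j · s u) ≡⟨ ·-assoc i j (s u) ⟩
      (i · j) · s u ∎))

  module _ {F : Set} {Π : Program P F} (Π-ok : ProgramRespects (SignedDescent r s) Π) where

    geq⇒signedDescent : ∀ {i p q} → Geq Π i p q → SignedDescent r s i p q
    geq⇒signedDescent here       = signedDescent-refl
    geq⇒signedDescent (step d g) =
      signedDescent-trans (direct⇒respects (SignedDescent r s) Π-ok d) (geq⇒signedDescent g)

    respects⇒callConsistent : CallConsistent Π
    respects⇒callConsistent p p≥₋p with geq⇒signedDescent p≥₋p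
    ... | inj₁ p<p       = <-irrefl refl p<p
    ... | inj₂ (_ , s≡-s) = s≢minus·s (s p) s≡-s

module _ {Pr Fun Lab : Set} (D : Theory Pr Fun Lab) where
  open Meta D

  representation-bodiless : All (λ c → body c ≡ []) representation
  representation-bodiless =
    ++⁺ (map⁺ (All.universal (λ _ → refl) (facts D)))
    (++⁺ (map⁺ (All.universal (λ _ → refl) (rules D)))
    (++⁺ (map⁺ (All.universal (λ _ → refl) (sup D)))
         (concat⁺ (map⁺ {f = negClauses} (All.universal (λ _ → refl ∷ refl ∷ []) (preds D))))))

  representation-respects : ∀ (ok : Sign → MetaPred → MetaPred → Set) →
    ProgramRespects ok representation
  representation-respects ok = All.map (λ {c} → bodiless⇒respects ok {c}) representation-bodiless

rank : MetaPred → ℕ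
rank strictOrDefeasible = 1
rank rule               = 2
rank definitely         = 3
rank loopDefinitely     = 3
rank lambda             = 4
rank loopLambda         = 4
rank defeasibly         = 5
rank loopDefeasibly     = 5
rank overruled₁         = 5
rank defeated           = 5
rank _                  = 0

sign : MetaPred → Sign
sign overruled₁ = minus
sign _          = plus

stratum : MetaPred → ℕ
stratum strictOrDefeasible = 1
stratum defeats            = 1
stratum rule               = 2
stratum definitely         = 3
stratum loopDefinitely     = 3
stratum lambda             = 4
stratum loopLambda         = 4
stratum overruled₂         = 5
stratum defeasibly         = 6
stratum loopDefeasibly     = 6
stratum _                  = 0

M-∂∥-signedDescent : ∀ {Pr Fun Lab : Set} (D : Theory Pr Fun Lab) →
  ProgramRespects (SignedDescent rank sign) (M-∂∥ D)
M-∂∥-signedDescent D = ++⁺ (representation-respects D _)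
  (toWitness {a? = programRespects? _ (signedDescent? rank sign) (common ++ lastPar)} _)
  where open Meta D

M-∂*∥-stratumOrder : ∀ {Pr Fun Lab : Set} (D : Theory Pr Fun Lab) →
  ProgramRespects (StratumOrder stratum) (M-∂*∥ D)
M-∂*∥-stratumOrder D = ++⁺ (representation-respects D _)
  (toWitness {a? = programRespects? _ (stratumOrder? stratum) (common ++ lastStar)} _)
  where open Meta D

proposition1 : ∀ {Pr Fun Lab : Set} (D : Theory Pr Fun Lab) →
    CallConsistent (M-∂∥ D) × Stratified (M-∂*∥ D)
proposition1 D =
    respects⇒callConsistent rank sign (M-∂∥-signedDescent D)
  , respects⇒stratified stratum (M-∂*∥-stratumOrder D)
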